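{- For every integer $k\ge 2$ there exists a cop-winning (undirected) edge periodic cycle $\mathcal{G}=(V,E,\tau)$ with $\mathrm{LCM}(L_{\mathcal{G}}) = k = \max(L_{\mathcal{G}})$ and $|V| = 4k-1$.
   Context: An edge periodic graph $\mathcal{G}=(V,E,\tau)$ consists of a finite undirected graph $G=(V,E)$ and a function $\tau: E\to\{0,1\}^*$ such that edge $e$ exists in time step $t\ge 0$ if and only if $\tau(e)[t \bmod |\tau(e)|]=1$; every edge exists in at least one time step. An edge periodic cycle is one whose underlying graph $G$ is a single cycle. $L_{\mathcal{G}}=\{|\tau(e)| : e\in E\}$ is the set of edge periods, $\max(L_{\mathcal{G}})$ its maximum and $\mathrm{LCM}(L_{\mathcal{G}})$ its least common multiple. The one-cop game: first the cop chooses a start vertex, then the robber; then in each time step $t=0,1,2,\dots$, first the cop and then the robber either stays or moves to an adjacent vertex along an edge present at time $t$. The cop catches the robber if after the cop's move in some time step both are on the same vertex. $\mathcal{G}$ is cop-winning if the cop has a strategy (including start vertex) catching the robber regardless of the robber's start vertex and moves. -}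

module Defs where

open import Data.Nat using (ℕ; zero; suc; _⊔_; _%_; _≤_)
open import Data.Nat.LCM using (lcm)
open import Data.Bool using (Bool; true; false)
open import Data.List using (List; []; _∷_; length; map; foldr)
open import Data.Fin using (Fin; toℕ)
open import Data.List.Base using (allFin)
open import Data.Product using (Σ; ∃; _×_; _,_)
open import Data.Sum using (_⊎_)
open import Relation.Binary.PropositionalEquality using (_≡_)
open import Relation.Nullary using (¬_)
open import Data.Empty using (⊥)

nth : List Bool → ℕ → Bool
nth []       _       = false
nth (b ∷ _)  zero    = b
nth (_ ∷ bs) (suc m) = nth bs m

Present : List Bool → ℕ → Set
Present []       t = ⊥
Present (b ∷ bs) t = nth (b ∷ bs) (t % suc (length bs)) ≡ true

-- The edge periodic cycle on n vertices: V = Fin n, and for each i : Fin n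
-- the edge e_i joins vertex i and vertex (i+1 mod n).  τ assigns the label of e_i.
-- "v is the cyclic successor of u":
IsNext : {n : ℕ} → Fin n → Fin n → Set
IsNext {n} u v = (suc (toℕ u) ≡ toℕ v) ⊎ ((suc (toℕ u) ≡ n) × (toℕ v ≡ 0))

ValidLabels : {n : ℕ} → (Fin n → List Bool) → Set
ValidLabels {n} τ = (e : Fin n) → ∃ λ t → Present (τ e) t

EdgeAt : {n : ℕ} → (Fin n → List Bool) → ℕ → Fin n → Fin n → Set
EdgeAt τ t u v = (IsNext u v × Present (τ u) t) ⊎ (IsNext v u × Present (τ v) t)

Move : {n : ℕ} → (Fin n → List Bool) → ℕ → Fin n → Fin n → Set
Move τ t u v = (u ≡ v) ⊎ EdgeAt τ t u v

-- CopWins τ t c r : at the beginning of time step t, cop on c and robber on r,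
-- the cop has a strategy that catches the robber in finitely many steps
-- (well-founded strategy tree; cop moves first, capture checked after cop's move).
data CopWins {n : ℕ} (τ : Fin n → List Bool) : ℕ → Fin n → Fin n → Set where
  catch : ∀ {t c r} c' → Move τ t c c' → c' ≡ r → CopWins τ t c r
  step  : ∀ {t c r} c' → Move τ t c c' → ¬ (c' ≡ r) →
          (∀ r' → Move τ t r r' → CopWins τ (suc t) c' r') → CopWins τ t c r

CopWinning : {n : ℕ} → (Fin n → List Bool) → Set
CopWinning {n} τ = Σ (Fin n) λ c₀ → (r₀ : Fin n) → CopWins τ 0 c₀ r₀

-- The list of edge periods (L_G as a list; max and lcm do not depend on multiplicity).
periods : {n : ℕ} → (Fin n → List Bool) → List ℕ
periods {n} τ = map (λ e → length (τ e)) (allFin n)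

maxPeriod : {n : ℕ} → (Fin n → List Bool) → ℕ
maxPeriod τ = foldr _⊔_ 0 (periods τ)

lcmPeriod : {n : ℕ} → (Fin n → List Bool) → ℕ
lcmPeriod τ = foldr lcm 1 (periods τ)

-- Take the cycle on the vertices 0, …, N with N = 4k − 2, edge i joining i and i + 1 (mod N + 1).
-- The two edges at vertex 0 (edges 0 and N) are hubs, present exactly at the multiples of k;
-- edge M = 2k − 1 is a gate, present exactly at the times ≡ k − 1 (mod k); every other edge is
-- always present. All periods are k or 1, so the maximum and the lcm are both k.
--
-- The labelling is invariant under the reflection i ↦ −i, so it suffices to catch a robber
-- starting in 0, …, M. The cop starts at 0 and climbs one vertex per time step, standing on
-- vertex t at time t; the gate is open when it is needed since M ≡ k − 1. A robber ahead of the
-- cop can pass the gate only at a time t ≡ k − 1, reaching M + 1 ≤ t + 1 + k, so it keeps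
-- within k of the clock. Hence if it ever wraps round from N to 0, which happens at a multiple
-- t of k, then N ≤ t + k: the hubs stay shut, and the robber stuck at 0, until the cop reaches
-- N. A robber that never wraps is pinned against N. Finally the cop waits on N until the hub
-- edge N opens (at the latest at time N + 2 = 4k) and steps onto 0.

module Submission where

open import Defs
open import Data.Nat using (ℕ; _≤_; _*_; _∸_)
open import Data.Fin using (Fin)
open import Data.Bool using (Bool)
open import Data.List using (List)
open import Data.Product using (Σ; _×_)
open import Relation.Binary.PropositionalEquality using (_≡_)

open import Data.Nat using (zero; suc; _+_; _<_; _⊔_; _%_; _≟_; _≤?_; z≤n; s≤s; s≤s⁻¹; z<s; NonZero)
open import Data.Nat.Properties
open import Data.Nat.DivMod using (n%1≡0; m%n%n≡m%n; %-distribˡ-+; [m+n]%n≡m%n; m*n%n≡0; m%n≤m; m<n⇒m%n≡m)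
open import Data.Nat.Divisibility using (_∣_; ∣-antisym; ∣-trans; ∣-reflexive; ∣⇒≤; 1∣_)
open import Data.Nat.LCM using (lcm; lcm-least; m∣lcm[m,n]; n∣lcm[m,n])
open import Data.Nat.Tactic.RingSolver using (solve-∀)
open import Data.Bool using (true; false)
open import Data.List using ([]; _∷_; length; replicate; foldr)
open import Data.List.Properties using (length-replicate; foldr-preservesᵇ; foldr-preservesᵒ)
open import Data.List.Membership.Propositional using (_∈_)
open import Data.List.Membership.Propositional.Properties using (∈-map⁺; ∈-allFin)
open import Data.List.Relation.Unary.All as All using (All)
open import Data.List.Relation.Unary.All.Properties using (map⁺; tabulate⁺)
import Data.List.Relation.Unary.Any as Any
open import Data.Fin using (zero; suc; toℕ; fromℕ<; opposite)
open import Data.Fin.Properties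
  using (toℕ-injective; toℕ-fromℕ<; toℕ<n; toℕ≤pred[n]; opposite-prop; opposite-involutive)
open import Data.Product using (∃; _,_)
open import Data.Sum as Sum using (_⊎_; inj₁; inj₂; [_,_]′)
open import Data.Unit using (⊤; tt)
open import Data.Empty using (⊥-elim)
open import Function using (const)
open import Function.Bundles using (_⇔_; mk⇔; Equivalence)
open import Relation.Nullary using (¬_; Dec; yes; no; contradiction)
open import Relation.Binary.PropositionalEquality using (refl; sym; trans; cong; subst; module ≡-Reasoning)

pulse : ℕ → ℕ → List Bool
pulse zero    r = true ∷ replicate r false
pulse (suc i) r = false ∷ pulse i r

length-pulse : ∀ i r → length (pulse i r) ≡ suc (i + r)
length-pulse zero    r = cong suc (length-replicate r)
length-pulse (suc i) r = cong suc (length-pulse i r)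

nth-replicate-false : ∀ r m → ¬ (nth (replicate r false) m ≡ true)
nth-replicate-false zero    m       ()
nth-replicate-false (suc r) zero    ()
nth-replicate-false (suc r) (suc m) = nth-replicate-false r m

nth-pulse⇒ : ∀ i r m → nth (pulse i r) m ≡ true → m ≡ i
nth-pulse⇒ zero    r zero    _ = refl
nth-pulse⇒ zero    r (suc m) p = contradiction p (nth-replicate-false r m)
nth-pulse⇒ (suc i) r zero    ()
nth-pulse⇒ (suc i) r (suc m) p = cong suc (nth-pulse⇒ i r m p)

nth-pulse-self : ∀ i r → nth (pulse i r) i ≡ true
nth-pulse-self zero    r = refl
nth-pulse-self (suc i) r = nth-pulse-self i r

nth-pulse : ∀ i r m → nth (pulse i r) m ≡ true ⇔ m ≡ i
nth-pulse i r m = mk⇔ (nth-pulse⇒ i r m) (λ { refl → nth-pulse-self i r })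

present-pulse : ∀ i r t → Present (pulse i r) t ⇔ t % suc (i + r) ≡ i
present-pulse zero    r t rewrite length-replicate r {x = false} = nth-pulse zero r (t % suc r)
present-pulse (suc i) r t rewrite length-pulse i r = nth-pulse (suc i) r (t % suc (suc (i + r)))

suc[m∸[1+n]]≡m∸n : ∀ {m n} → n < m → suc (m ∸ suc n) ≡ m ∸ n
suc[m∸[1+n]]≡m∸n (s≤s n≤m) = sym (+-∸-assoc 1 n≤m)

-- i ↦ −i (mod n + 1), since toℕ (opposite i) = n − 1 − toℕ i.
reflect : ∀ {n} → Fin (suc n) → Fin (suc n)
reflect zero    = zero
reflect (suc i) = suc (opposite i)

reflect-involutive : ∀ {n} (u : Fin (suc n)) → reflect (reflect u) ≡ u
reflect-involutive zero    = refl
reflect-involutive (suc i) = cong suc (opposite-involutive i)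

toℕ-reflect-suc : ∀ {n} (i : Fin n) → toℕ (reflect (suc i)) ≡ n ∸ toℕ i
toℕ-reflect-suc i = trans (cong suc (opposite-prop i)) (suc[m∸[1+n]]≡m∸n (toℕ<n i))

toℕ-reflect-next : ∀ {n} {u v : Fin (suc n)} → IsNext u v → toℕ (reflect v) ≡ n ∸ toℕ u
toℕ-reflect-next {n} {v = suc v} (inj₁ u+1≡v+1) =
  trans (toℕ-reflect-suc v) (cong (n ∸_) (suc-injective (sym u+1≡v+1)))
toℕ-reflect-next {n} {v = zero} (inj₂ (u+1≡n+1 , _)) =
  trans (sym (n∸n≡0 n)) (cong (n ∸_) (suc-injective (sym u+1≡n+1)))

reflect-next : ∀ {n} {u v : Fin (suc n)} → IsNext u v → IsNext (reflect v) (reflect u)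
reflect-next {u = zero}  {suc _} u→v@(inj₁ _) = inj₂ (cong suc (toℕ-reflect-next u→v) , refl)
reflect-next {n} {suc u} {suc v} u→v@(inj₁ _) = inj₁ (begin
  suc (toℕ (reflect (suc v))) ≡⟨ cong suc (toℕ-reflect-next u→v) ⟩
  suc (n ∸ suc (toℕ u))       ≡⟨ suc[m∸[1+n]]≡m∸n (toℕ<n u) ⟩
  n ∸ toℕ u                   ≡⟨ toℕ-reflect-suc u ⟨
  toℕ (reflect (suc u))       ∎)
  where open ≡-Reasoning
reflect-next {u = zero}  {zero} u→v@(inj₂ _) = u→v
reflect-next {n} {suc u} {zero} (inj₂ (u+2≡n+1 , _)) = inj₁ (sym (begin
  toℕ (reflect (suc u)) ≡⟨ toℕ-reflect-suc u ⟩
  n ∸ toℕ u             ≡⟨ cong (_∸ toℕ u) (suc-injective u+2≡n+1) ⟨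
  suc (toℕ u) ∸ toℕ u   ≡⟨ m+n∸n≡m 1 (toℕ u) ⟩
  1                     ∎))
  where open ≡-Reasoning

module _ {n} {τ : Fin (suc n) → List Bool}
         (τ-reflect : ∀ {u v} → IsNext u v → τ (reflect v) ≡ τ u) where

  reflect-move : ∀ {t u v} → Move τ t u v → Move τ t (reflect u) (reflect v)
  reflect-move (inj₁ u≡v) = inj₁ (cong reflect u≡v)
  reflect-move {t} (inj₂ (inj₁ (u→v , p))) =
    inj₂ (inj₂ (reflect-next u→v , subst (λ w → Present w t) (sym (τ-reflect u→v)) p))
  reflect-move {t} (inj₂ (inj₂ (v→u , p))) =
    inj₂ (inj₁ (reflect-next v→u , subst (λ w → Present w t) (sym (τ-reflect v→u)) p))

module _ {n} {τ : Fin n → List Bool} (σ : Fin n → Fin n)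
         (σ-involutive : ∀ u → σ (σ u) ≡ u)
         (σ-move : ∀ {t u v} → Move τ t u v → Move τ t (σ u) (σ v)) where

  CopWins-map : ∀ {t c r} → CopWins τ t c r → CopWins τ t (σ c) (σ r)
  CopWins-map (catch c' m refl) = catch (σ c') (σ-move m) refl
  CopWins-map {t} (step c' m c'≢r wins) = step (σ c') (σ-move m) σc'≢σr λ r' m' →
    subst (CopWins τ (suc t) (σ c')) (σ-involutive r')
      (CopWins-map (wins (σ r') (subst (λ w → Move τ t w (σ r')) (σ-involutive _) (σ-move m'))))
    where
    σc'≢σr : ¬ (σ c' ≡ σ _)
    σc'≢σr e = c'≢r (trans (sym (σ-involutive c')) (trans (cong σ e) (σ-involutive _)))

foldr-⊔-≡ : ∀ {m} {xs : List ℕ} → All (_≤ m) xs → m ∈ xs → foldr _⊔_ 0 xs ≡ m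
foldr-⊔-≡ {m} {xs} bounded m∈xs = ≤-antisym
  (foldr-preservesᵇ ⊔-lub z≤n bounded)
  (foldr-preservesᵒ (λ x y → [ m≤n⇒m≤n⊔o y , m≤n⇒m≤o⊔n x ]′)
    0 xs (inj₂ (Any.map ≤-reflexive m∈xs)))

foldr-lcm-≡ : ∀ {m} {xs : List ℕ} → All (_∣ m) xs → m ∈ xs → foldr lcm 1 xs ≡ m
foldr-lcm-≡ {m} {xs} dividing m∈xs = ∣-antisym
  (foldr-preservesᵇ lcm-least (1∣ m) dividing)
  (foldr-preservesᵒ (λ x y → [ (λ m∣x → ∣-trans m∣x (m∣lcm[m,n] x y))
                              , (λ m∣y → ∣-trans m∣y (n∣lcm[m,n] x y)) ]′)
    1 xs (inj₂ (Any.map ∣-reflexive m∈xs)))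

module _ {n} (τ : Fin n → List Bool) {k} (periods-∣ : ∀ e → length (τ e) ∣ k)
         (e₀ : Fin n) (e₀-period : length (τ e₀) ≡ k) where

  private
    periods-dividing : All (_∣ k) (periods τ)
    periods-dividing = map⁺ (tabulate⁺ periods-∣)

    k∈periods : k ∈ periods τ
    k∈periods = subst (_∈ periods τ) e₀-period (∈-map⁺ (λ e → length (τ e)) (∈-allFin e₀))

  lcmPeriod≡ : lcmPeriod τ ≡ k
  lcmPeriod≡ = foldr-lcm-≡ periods-dividing k∈periods

  maxPeriod≡ : .{{NonZero k}} → maxPeriod τ ≡ k
  maxPeriod≡ = foldr-⊔-≡ (All.map ∣⇒≤ periods-dividing) k∈periods

no-multiple-between : ∀ {k} .{{_ : NonZero k}} {t s} → t % k ≡ 0 → t < s → s < t + k → ¬ (s % k ≡ 0)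
no-multiple-between {k} {t} {s} t%k≡0 t<s s<t+k s%k≡0 = m>n⇒m∸n≢0 t<s e≡0
  where
  open ≡-Reasoning
  e = s ∸ t
  e+t≡s : e + t ≡ s
  e+t≡s = m∸n+n≡m (<⇒≤ t<s)
  e<k : e < k
  e<k = +-cancelʳ-< t e k (subst (_< k + t) (sym e+t≡s) (subst (s <_) (+-comm t k) s<t+k))
  e≡0 : e ≡ 0
  e≡0 = begin
    e                       ≡⟨ m<n⇒m%n≡m e<k ⟨
    e % k                   ≡⟨ m%n%n≡m%n e k ⟨
    e % k % k               ≡⟨ cong (_% k) (+-identityʳ (e % k)) ⟨
    (e % k + 0) % k         ≡⟨ cong (λ r → (e % k + r) % k) t%k≡0 ⟨
    (e % k + t % k) % k     ≡⟨ %-distribˡ-+ e t k ⟨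
    (e + t) % k             ≡⟨ cong (_% k) e+t≡s ⟩
    s % k                   ≡⟨ s%k≡0 ⟩
    0                       ∎

module Cycle (j : ℕ) where

  k M N : ℕ
  k = 2 + j
  M = suc j + k
  N = 4 * k ∸ 2

  V : Set
  V = Fin (suc N)

  N≡M+M : N ≡ M + M
  N≡M+M = lemma j
    where
    lemma : ∀ j → j + 3 * (2 + j) ≡ (suc j + (2 + j)) + (suc j + (2 + j))
    lemma = solve-∀

  M<N : M < N
  M<N = subst (M <_) (sym N≡M+M) (m<m+n M {M} z<s)

  N≢0 : ¬ (N ≡ 0)
  N≢0 N≡0 = contradiction (subst (M <_) N≡0 M<N) λ ()

  N∸M≡M : N ∸ M ≡ M
  N∸M≡M = trans (cong (_∸ M) N≡M+M) (m+n∸n≡m M M)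

  [2+N]%k≡0 : (2 + N) % k ≡ 0
  [2+N]%k≡0 = subst (λ x → x % k ≡ 0) (sym (m+[n∸m]≡n {2} {4 * k} (s≤s (s≤s z≤n)))) (m*n%n≡0 4 k)

  M%k≡suc-j : M % k ≡ suc j
  M%k≡suc-j = trans ([m+n]%n≡m%n (suc j) k) (m<n⇒m%n≡m ≤-refl)

  data Kind : Set where
    hub gate permanent : Kind

  word : Kind → List Bool
  word hub       = pulse 0 (suc j)
  word gate      = pulse (suc j) 0
  word permanent = true ∷ []

  OpenAt : Kind → ℕ → Set
  OpenAt hub       t = t % k ≡ 0
  OpenAt gate      t = t % k ≡ suc j
  OpenAt permanent t = ⊤

  present-word : ∀ κ t → Present (word κ) t ⇔ OpenAt κ t
  present-word hub       t = present-pulse 0 (suc j) t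
  present-word gate      t = subst (λ p → Present (word gate) t ⇔ t % suc (suc p) ≡ suc j) (+-identityʳ j)
                                   (present-pulse (suc j) 0 t)
  present-word permanent t = mk⇔ (const tt) (λ _ → cong (nth (true ∷ [])) (n%1≡0 t))

  word-period : ∀ κ → length (word κ) ∣ k
  word-period hub       = ∣-reflexive (length-pulse 0 (suc j))
  word-period gate      = ∣-reflexive (trans (length-pulse (suc j) 0) (cong (2 +_) (+-identityʳ j)))
  word-period permanent = 1∣ k

  word-opens : ∀ κ → ∃ (OpenAt κ)
  word-opens hub       = 0 , refl
  word-opens gate      = suc j , m<n⇒m%n≡m ≤-refl
  word-opens permanent = 0 , tt

  kind : ℕ → Kind
  kind i with i ≟ 0 | i ≟ N | i ≟ M
  ... | yes _ | _     | _     = hub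
  ... | no _  | yes _ | _     = hub
  ... | no _  | no _  | yes _ = gate
  ... | no _  | no _  | no _  = permanent

  kind-hub : ∀ {i} → i ≡ 0 ⊎ i ≡ N → kind i ≡ hub
  kind-hub {i} i∈hub with i ≟ 0 | i ≟ N | i ≟ M
  ... | yes _  | _      | _ = refl
  ... | no _   | yes _  | _ = refl
  ... | no i≢0 | no i≢N | _ = ⊥-elim ([ i≢0 , i≢N ]′ i∈hub)

  kind-gate : kind M ≡ gate
  kind-gate with M ≟ 0 | M ≟ N | M ≟ M
  ... | no _ | yes M≡N | _      = contradiction M≡N (<⇒≢ M<N)
  ... | no _ | no _    | yes _  = refl
  ... | no _ | no _    | no M≢M = contradiction refl M≢M

  kind-permanent : ∀ {i} → ¬ (i ≡ 0) → ¬ (i ≡ N) → ¬ (i ≡ M) → kind i ≡ permanent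
  kind-permanent {i} i≢0 i≢N i≢M with i ≟ 0 | i ≟ N | i ≟ M
  ... | yes i≡0 | _       | _       = contradiction i≡0 i≢0
  ... | no _    | yes i≡N | _       = contradiction i≡N i≢N
  ... | no _    | no _    | yes i≡M = contradiction i≡M i≢M
  ... | no _    | no _    | no _    = refl

  kind-reflect : ∀ {i} → i ≤ N → kind (N ∸ i) ≡ kind i
  kind-reflect {i} i≤N with i ≟ 0 | i ≟ N | i ≟ M
  ... | yes refl | _        | _        = kind-hub (inj₂ refl)
  ... | no _     | yes refl | _        = kind-hub (inj₁ (n∸n≡0 N))
  ... | no _     | no _     | yes refl = trans (cong kind N∸M≡M) kind-gate
  ... | no i≢0   | no i≢N   | no i≢M   = kind-permanent
    (λ e → i≢N (reflect-back e))
    (λ e → i≢0 (trans (reflect-back e) (n∸n≡0 N)))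
    (λ e → i≢M (trans (reflect-back e) N∸M≡M))
    where
    reflect-back : ∀ {x} → N ∸ i ≡ x → i ≡ N ∸ x
    reflect-back e = trans (sym (m∸[m∸n]≡n i≤N)) (cong (N ∸_) e)

  τ : V → List Bool
  τ e = word (kind (toℕ e))

  Open : ℕ → ℕ → Set
  Open x t = OpenAt (kind x) t

  present⇒open : ∀ {x t} → Present (word (kind x)) t → Open x t
  present⇒open {x} {t} = Equivalence.to (present-word (kind x) t)

  open⇒present : ∀ {x t} → Open x t → Present (word (kind x)) t
  open⇒present {x} {t} = Equivalence.from (present-word (kind x) t)

  τ-reflect : ∀ {u v : V} → IsNext u v → τ (reflect v) ≡ τ u
  τ-reflect {u} u→v = cong word (trans (cong kind (toℕ-reflect-next u→v)) (kind-reflect (toℕ≤pred[n] u)))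

  hub-shut : ∀ {i t} → i ≡ 0 ⊎ i ≡ N → Open i t → t % k ≡ 0
  hub-shut {t = t} i∈hub = subst (λ κ → OpenAt κ t) (kind-hub i∈hub)

  hub-open : ∀ {i t} → i ≡ 0 ⊎ i ≡ N → t % k ≡ 0 → Open i t
  hub-open {t = t} i∈hub = subst (λ κ → OpenAt κ t) (sym (kind-hub i∈hub))

  gate-shut : ∀ {t} → Open M t → t % k ≡ suc j
  gate-shut {t} = subst (λ κ → OpenAt κ t) kind-gate

  gate-open : ∀ {t} → t % k ≡ suc j → Open M t
  gate-open {t} = subst (λ κ → OpenAt κ t) (sym kind-gate)

  gate-bound : ∀ {t} → Open M t → M ≤ t + k
  gate-bound {t} open-M = +-monoˡ-≤ k (subst (_≤ t) (gate-shut open-M) (m%n≤m t k))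

  open-on-schedule : ∀ {t} → t < N → Open t t
  open-on-schedule {t} t<N = by-cases (t ≟ 0) (t ≟ M)
    where
    by-cases : Dec (t ≡ 0) → Dec (t ≡ M) → Open t t
    by-cases (yes t≡0) _         = hub-open (inj₁ t≡0) (cong (_% k) t≡0)
    by-cases (no _)    (yes t≡M) = subst (λ x → Open x x) (sym t≡M) (gate-open M%k≡suc-j)
    by-cases (no t≢0)  (no t≢M)  =
      subst (λ κ → OpenAt κ t) (sym (kind-permanent t≢0 (<⇒≢ t<N) t≢M)) tt

  τ-valid : ValidLabels τ
  τ-valid e with word-opens (kind (toℕ e))
  ... | t , open-e = t , open⇒present open-e

  data Step (t : ℕ) : ℕ → ℕ → Set where
    stay      : ∀ {x} → Step t x x
    up        : ∀ {x} → x < N → Open x t → Step t x (suc x)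
    down      : ∀ {x} → x < N → Open x t → Step t (suc x) x
    wrap-up   : ∀ {x} → x ≡ N → Open x t → Step t x 0
    wrap-down : ∀ {y} → y ≡ N → Open y t → Step t 0 y

  reverse : ∀ {t x y} → Step t x y → Step t y x
  reverse stay              = stay
  reverse (up x<N p)        = down x<N p
  reverse (down x<N p)      = up x<N p
  reverse (wrap-up x≡N p)   = wrap-down x≡N p
  reverse (wrap-down y≡N p) = wrap-up y≡N p

  step-of-next : ∀ {t} {u v : V} → IsNext u v → Present (τ u) t → Step t (toℕ u) (toℕ v)
  step-of-next {t} {u} {v} (inj₁ u+1≡v) p =
    subst (Step t (toℕ u)) u+1≡v
      (up (subst (_≤ N) (sym u+1≡v) (toℕ≤pred[n] v)) (present⇒open p))
  step-of-next {t} {u} (inj₂ (u+1≡N+1 , v≡0)) p =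
    subst (Step t (toℕ u)) (sym v≡0) (wrap-up (suc-injective u+1≡N+1) (present⇒open p))

  step-of-move : ∀ {t} {u v : V} → Move τ t u v → Step t (toℕ u) (toℕ v)
  step-of-move (inj₁ refl)             = stay
  step-of-move (inj₂ (inj₁ (u→v , p))) = step-of-next u→v p
  step-of-move (inj₂ (inj₂ (v→u , p))) = reverse (step-of-next v→u p)

  advance : ∀ {t} {u v : V} → suc (toℕ u) ≡ toℕ v → Open (toℕ u) t → Move τ t u v
  advance {t} u→v p = inj₂ (inj₁ (inj₁ u→v , open⇒present p))

  wrap : ∀ {t} {u v : V} → toℕ u ≡ N → toℕ v ≡ 0 → Open (toℕ u) t → Move τ t u v
  wrap {t} u≡N v≡0 p = inj₂ (inj₁ (inj₂ (cong suc u≡N , v≡0) , open⇒present p))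

  -- Where the robber may be at time t while the cop stands on vertex t.
  Ahead : ℕ → ℕ → Set
  Ahead t x = t ≤ x × (x ≤ M ⊎ x ≤ t + k)

  HubShut : ℕ → Set
  HubShut t = ∀ s → t ≤ s → s < N → ¬ (s % k ≡ 0)

  Trapped : ℕ → ℕ → Set
  Trapped t x = x ≡ 0 × HubShut t

  Invariant : ℕ → ℕ → Set
  Invariant t x = Ahead t x ⊎ Trapped t x

  stuck-at-hub : ∀ {t x y} → ¬ (t % k ≡ 0) → x ≡ 0 → Step t x y → y ≡ 0
  stuck-at-hub t%k≢0 refl stay              = refl
  stuck-at-hub {t} t%k≢0 refl (up _ p)      = contradiction (hub-shut {t = t} (inj₁ refl) p) t%k≢0
  stuck-at-hub t%k≢0 refl (wrap-up 0≡N _)   = contradiction (sym 0≡N) N≢0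
  stuck-at-hub {t} t%k≢0 refl (wrap-down y≡N p) = contradiction (hub-shut {t = t} (inj₂ y≡N) p) t%k≢0

  trapped-step : ∀ {t x y} → t < N → Trapped t x → Step t x y → Trapped (suc t) y
  trapped-step {t} t<N (x≡0 , shut) x→y =
    stuck-at-hub (shut t ≤-refl t<N) x≡0 x→y , λ s t<s → shut s (<⇒≤ {t} {s} t<s)

  advance-bound : ∀ {t x} → x ≤ M ⊎ x ≤ t + k → Open x t → suc x ≤ M ⊎ suc x ≤ suc t + k
  advance-bound (inj₁ x≤M) p with m≤n⇒m<n∨m≡n x≤M
  ... | inj₁ x<M  = inj₁ x<M
  ... | inj₂ refl = inj₂ (s≤s (gate-bound p))
  advance-bound (inj₂ x≤t+k) _ = inj₂ (s≤s x≤t+k)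

  ahead-step : ∀ {t x y} → suc t < x → x ≤ M ⊎ x ≤ t + k → Step t x y → Invariant (suc t) y
  ahead-step t+1<x bound stay =
    inj₁ (<⇒≤ t+1<x , Sum.map₂ m≤n⇒m≤1+n bound)
  ahead-step t+1<x bound (up _ p) =
    inj₁ (m≤n⇒m≤1+n (<⇒≤ t+1<x) , advance-bound bound p)
  ahead-step t+1<x bound (down _ _) =
    inj₁ (s≤s⁻¹ t+1<x ,
          Sum.map (≤-trans (n≤1+n _)) (λ x≤t+k → m≤n⇒m≤1+n (≤-trans (n≤1+n _) x≤t+k)) bound)
  ahead-step {t} t+1<x bound (wrap-up x≡N p) = inj₂ (refl , shut)
    where
    N≤t+k : N ≤ t + k
    N≤t+k = [ (λ x≤M → contradiction (subst (_≤ M) x≡N x≤M) (<⇒≱ M<N))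
            , subst (_≤ t + k) x≡N ]′ bound
    shut : HubShut (suc t)
    shut s t<s s<N = no-multiple-between (hub-shut (inj₂ x≡N) p) t<s (<-≤-trans s<N N≤t+k)
  ahead-step () _ (wrap-down _ _)

  wait : ∀ d t {c r : V} → (d + t) % k ≡ 0 → toℕ c ≡ N → toℕ r ≡ 0 → CopWins τ t c r
  wait d t {c} {r} [d+t]%k≡0 c≡N r≡0 with t % k ≟ 0
  ... | yes t%k≡0 = catch r (wrap c≡N r≡0 (hub-open {t = t} (inj₂ c≡N) t%k≡0)) refl
  wait zero    t [d+t]%k≡0 _ _ | no t%k≢0 = contradiction [d+t]%k≡0 t%k≢0
  wait (suc d) t {c} {r} [d+t]%k≡0 c≡N r≡0 | no t%k≢0 =
    step c (inj₁ refl) (λ c≡r → N≢0 (trans (sym c≡N) (trans (cong toℕ c≡r) r≡0))) λ r' r→r' →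
      wait d (suc t) (subst (λ s → s % k ≡ 0) (sym (+-suc d t)) [d+t]%k≡0) c≡N
        (stuck-at-hub t%k≢0 r≡0 (step-of-move r→r'))

  finish : ∀ {c r : V} → toℕ c ≡ N → Invariant N (toℕ r) → CopWins τ N c r
  finish {c} {r} c≡N (inj₁ (N≤r , _)) =
    catch c (inj₁ refl) (toℕ-injective (trans c≡N (≤-antisym N≤r (toℕ≤pred[n] r))))
  finish c≡N (inj₂ (r≡0 , _)) = wait 2 N [2+N]%k≡0 c≡N r≡0

  sweep : ∀ d t {c r : V} → d + t ≡ N → toℕ c ≡ t → Invariant t (toℕ r) → CopWins τ t c r
  sweep zero    t refl = finish
  sweep (suc d) t {c} {r} d+1+t≡N c≡t = respond
    where
    t<N : t < N
    t<N = subst (t <_) d+1+t≡N (s≤s (m≤n+m t d))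
    c⁺ : V
    c⁺ = fromℕ< (s≤s t<N)
    c⁺≡t+1 : toℕ c⁺ ≡ suc t
    c⁺≡t+1 = toℕ-fromℕ< (s≤s t<N)
    c→c⁺ : Move τ t c c⁺
    c→c⁺ = advance (trans (cong suc c≡t) (sym c⁺≡t+1))
                   (subst (λ x → Open x t) (sym c≡t) (open-on-schedule t<N))
    continue : ∀ {r'} → Invariant (suc t) (toℕ r') → CopWins τ (suc t) c⁺ r'
    continue = sweep d (suc t) (trans (+-suc d t) d+1+t≡N) c⁺≡t+1
    respond : Invariant t (toℕ r) → CopWins τ t c r
    respond (inj₁ (t≤r , bound)) with m≤n⇒m<n∨m≡n t≤r
    ... | inj₂ t≡r = catch c (inj₁ refl) (toℕ-injective (trans c≡t t≡r))
    ... | inj₁ t<r with m≤n⇒m<n∨m≡n t<r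
    ...   | inj₂ t+1≡r = catch c⁺ c→c⁺ (toℕ-injective (trans c⁺≡t+1 t+1≡r))
    ...   | inj₁ t+1<r =
            step c⁺ c→c⁺ (λ c⁺≡r → <⇒≢ t+1<r (trans (sym c⁺≡t+1) (cong toℕ c⁺≡r)))
              λ r' r→r' →
              continue (ahead-step t+1<r bound (step-of-move r→r'))
    respond (inj₂ trapped@(r≡0 , _)) =
      step c⁺ c→c⁺ (λ c⁺≡r → 1+n≢0 (trans (sym c⁺≡t+1) (trans (cong toℕ c⁺≡r) r≡0)))
        λ r' r→r' →
        continue (inj₂ (trapped-step t<N trapped (step-of-move r→r')))

  sweep-from-0 : ∀ {r : V} → toℕ r ≤ M → CopWins τ 0 zero r
  sweep-from-0 r≤M = sweep N 0 (+-identityʳ N) refl (inj₁ (z≤n , inj₁ r≤M))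

  cop-wins : (r : V) → CopWins τ 0 zero r
  cop-wins r with toℕ r ≤? M
  ... | yes r≤M = sweep-from-0 r≤M
  cop-wins zero    | no r≰M = contradiction z≤n r≰M
  cop-wins (suc r) | no r≰M =
    subst (CopWins τ 0 zero) (reflect-involutive (suc r))
      (CopWins-map reflect reflect-involutive (reflect-move τ-reflect) (sweep-from-0 reflected≤M))
    where
    reflected≤M : toℕ (reflect (suc r)) ≤ M
    reflected≤M = begin
      toℕ (reflect (suc r)) ≡⟨ toℕ-reflect-suc r ⟩
      N ∸ toℕ r             ≤⟨ ∸-monoʳ-≤ N (s≤s⁻¹ (≰⇒> r≰M)) ⟩
      N ∸ M                 ≡⟨ N∸M≡M ⟩
      M                     ∎
      where open ≤-Reasoning

lemma1 : (k : ℕ) → 2 ≤ k →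
    Σ (Fin (4 * k ∸ 1) → List Bool) λ τ →
    ValidLabels τ × CopWinning τ × (lcmPeriod τ ≡ k) × (maxPeriod τ ≡ k)
lemma1 (suc zero) (s≤s ())
lemma1 (suc (suc j)) _ =
  τ , τ-valid , (zero , cop-wins) ,
  lcmPeriod≡ τ τ-period zero τ-period-zero , maxPeriod≡ τ τ-period zero τ-period-zero
  where
  open Cycle j
  τ-period : ∀ e → length (τ e) ∣ k
  τ-period e = word-period (kind (toℕ e))
  τ-period-zero : length (τ zero) ≡ k
  τ-period-zero = length-pulse 0 (suc j)
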